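{- Let $Q=\{q_1<\cdots<q_k\}$ and $W=\{w_1<\cdots<w_k\}$ be disjoint finite subsets of $\mathbb Z_{\ge 2}$ with the same number $k$ of elements. Then $(Q,W)$ is admissible if and only if $q_j>w_j$ for every $j\in\{1,\dots,k\}$.
   Context: A circular $n$-permutation is a permutation $\sigma=(\sigma(1),\dots,\sigma(n))$ of $[n]=\{1,\dots,n\}$ with the cyclic conventions $\sigma(0)=\sigma(n)$, $\sigma(n+1)=\sigma(1)$, considered modulo cyclic rotation; the set of these is $\overline{\mathfrak S}_n$. $\sigma(i)$ is a pinnacle if $\sigma(i-1)<\sigma(i)>\sigma(i+1)$ and a vale if $\sigma(i-1)>\sigma(i)<\sigma(i+1)$; $P(\sigma)$, $V(\sigma)$ are the sets of pinnacles and vales. For subsets $Q,W\subset\mathbb Z_{\ge2}$, the pair $(Q,W)$ is $n$-admissible if $n>\max Q$ and there exists $\sigma\in\overline{\mathfrak S}_n$ with $P(\sigma)=Q\cup\{n\}$ and $V(\sigma)=W\cup\{1\}$; it is admissible if it is $n$-admissible for some $n$. -}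

module Defs where

open import Data.Nat using (ℕ; zero; suc; _+_; _<_)
open import Data.Nat.DivMod using (_mod_)
open import Data.Fin using (Fin; toℕ)
open import Data.Fin.Permutation using (Permutation′; _⟨$⟩ʳ_)
open import Data.Product using (Σ; ∃; _×_)
open import Data.Sum using (_⊎_)
open import Relation.Binary.PropositionalEquality using (_≡_)
open import Function.Bundles using (_⇔_)

-- A (linear representative of a) circular n-permutation: positions Fin n
-- (position i : Fin n stands for index toℕ i + 1), values in [n] = {1,…,n}.
-- value π i = σ(i+1) = 1 + π(i).
value : {n : ℕ} → Permutation′ n → Fin n → ℕ
value π i = suc (toℕ (π ⟨$⟩ʳ i))

next : {n : ℕ} → Fin n → Fin n
next {suc m} i = suc (toℕ i) mod suc m

prev : {n : ℕ} → Fin n → Fin n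
prev {suc m} i = (toℕ i + m) mod suc m

IsPinnacle : {n : ℕ} → Permutation′ n → ℕ → Set
IsPinnacle π x = ∃ λ i → value π i ≡ x × value π (prev i) < value π i × value π (next i) < value π i

IsVale : {n : ℕ} → Permutation′ n → ℕ → Set
IsVale π x = ∃ λ i → value π i ≡ x × value π i < value π (prev i) × value π i < value π (next i)

NAdmissible : (Q W : ℕ → Set) → ℕ → Set
NAdmissible Q W n =
  (∀ q → Q q → q < n) ×
  Σ (Permutation′ n) λ π →
    (∀ x → IsPinnacle π x ⇔ (Q x ⊎ x ≡ n)) ×
    (∀ x → IsVale π x ⇔ (W x ⊎ x ≡ 1))

Admissible : (Q W : ℕ → Set) → Set
Admissible Q W = ∃ λ n → NAdmissible Q W n

{-# OPTIONS --safe #-}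
-- Fix x = q_j with q_j < w_j. Around the cycle, the values ≤ x form runs, each entered by a
-- descent from a value > x; counting descents shows that there are strictly more vales ≤ x than
-- pinnacles ≤ x. But q_1, …, q_j are pinnacles ≤ x, while the vales ≤ x lie among 1, w_1, …, w_(j-1).
--
-- When every w_j < q_j, the cyclic arrangement q_1 w_1 q_2 w_2 … q_k w_k n, followed by the
-- remaining values in decreasing order and then 1, has pinnacles exactly Q ∪ {n} and vales exactly W ∪ {1}.
module Submission where

open import Defs
open import Level using (Level; 0ℓ)
open import Data.Nat using (ℕ; zero; suc; _+_; _*_; _∸_; _<_; _≤_; z≤n; s≤s; s≤s⁻¹; _≤?_; _<?_; _≟_)
open import Data.Nat.Properties
open import Data.Nat.DivMod using (_%_; m<n⇒m%n≡m; n%n≡0; [m+n]%n≡m%n)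
open import Data.Fin using (Fin; zero; suc; toℕ; fromℕ; fromℕ<; punchOut) renaming (_<_ to _<ᶠ_)
open import Data.Fin.Properties as Fin using (toℕ-injective; toℕ<n; toℕ-fromℕ; toℕ-fromℕ<; any?; punchOut-injective; injective⇒≤) renaming (_<?_ to _<ᶠ?_)
open import Data.Fin.Permutation using (Permutation′; _⟨$⟩ʳ_; _⟨$⟩ˡ_; permutation; inverseˡ; inverseʳ)
open import Data.Vec using (Vec; lookup; _∷_)
open import Data.Vec.Membership.Propositional using (_∈_)
open import Data.Vec.Membership.Propositional.Properties using (∈-lookup)
open import Data.Vec.Relation.Unary.Any using (index)
open import Data.Vec.Relation.Unary.Any.Properties using (lookup-index)
open import Data.Product using (Σ; ∃; _×_; _,_; proj₁; proj₂)
open import Data.Sum using (_⊎_; inj₁; inj₂)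
open import Data.Empty using (⊥; ⊥-elim)
open import Function using (_∘_; _⇔_; mk⇔; Equivalence; Injective)
open import Relation.Nullary using (¬_; Dec; yes; no; contradiction)
open import Relation.Nullary.Decidable using (_×-dec_; _⊎-dec_; ¬?)
open import Relation.Unary using (Pred; Decidable; _⊆_; _∪_; ∁)
open import Relation.Unary.Properties using (_∪?_; ∁?)
open import Relation.Binary.PropositionalEquality
open import Relation.Binary using (tri<; tri≈; tri>)
open import Algebra.Properties.CommutativeMonoid.Sum +-0-commutativeMonoid
  using (sum; sum-cong-≗; ∑-comm; ∑-distrib-+; sum-permute)

private variable
  ℓ : Level
  m n : ℕ
  A B C : Set ℓ

indicator : Dec A → ℕ
indicator (yes _) = 1
indicator (no _)  = 0

indicator≤1 : (A? : Dec A) → indicator A? ≤ 1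
indicator≤1 (yes _) = ≤-refl
indicator≤1 (no _)  = z≤n

indicator-yes : (A? : Dec A) → A → indicator A? ≡ 1
indicator-yes (yes _) _  = refl
indicator-yes (no ¬a) a = contradiction a ¬a

indicator-no : (A? : Dec A) → ¬ A → indicator A? ≡ 0
indicator-no (yes a) ¬a = contradiction a ¬a
indicator-no (no _)  _  = refl

≤-indicator : (A? : Dec A) {s : ℕ} → s ≤ 1 → (0 < s → A) → s ≤ indicator A?
≤-indicator A? {zero}  _         _ = z≤n
≤-indicator A? {suc _} (s≤s z≤n) f = ≤-reflexive (sym (indicator-yes A? (f (s≤s z≤n))))

indicator-≤ : (A? : Dec A) {s : ℕ} → (A → 1 ≤ s) → indicator A? ≤ s
indicator-≤ (yes a) f = f a
indicator-≤ (no _)  _ = z≤n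

indicator-mono : (A? : Dec A) (B? : Dec B) → (A → B) → indicator A? ≤ indicator B?
indicator-mono (yes a) B? f = ≤-reflexive (sym (indicator-yes B? (f a)))
indicator-mono (no _)  _  _ = z≤n

indicator-cong : (A? : Dec A) (B? : Dec B) → (A → B) → (B → A) → indicator A? ≡ indicator B?
indicator-cong A? B? f g = ≤-antisym (indicator-mono A? B? f) (indicator-mono B? A? g)

indicator-⊎ : (A? : Dec A) (B? : Dec B) (C? : Dec C) → (A → B ⊎ C) →
              indicator A? ≤ indicator B? + indicator C?
indicator-⊎ (no _)  _  _  _ = z≤n
indicator-⊎ (yes a) B? C? f with f a
... | inj₁ b = ≤-trans (indicator-mono (yes a) B? (λ _ → b)) (m≤m+n _ _)
... | inj₂ c = ≤-trans (indicator-mono (yes a) C? (λ _ → c)) (m≤n+m _ _)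

indicator-⊎-disjoint : (A? : Dec A) (B? : Dec B) → (A → B → ⊥) →
                       indicator A? + indicator B? ≤ indicator (A? ⊎-dec B?)
indicator-⊎-disjoint A?@(no _)  B?        _        = indicator-mono B? (A? ⊎-dec B?) inj₂
indicator-⊎-disjoint A?@(yes _) B?@(no _) _        = ≤-trans (≤-reflexive (+-identityʳ 1)) (indicator-mono A? (A? ⊎-dec B?) inj₁)
indicator-⊎-disjoint (yes a)    (yes b)   disjoint = contradiction b (disjoint a)

sum-mono-≤ : (f g : Fin n → ℕ) → (∀ i → f i ≤ g i) → sum f ≤ sum g
sum-mono-≤ {zero}  f g f≤g = z≤n
sum-mono-≤ {suc n} f g f≤g = +-mono-≤ (f≤g zero) (sum-mono-≤ (f ∘ suc) (g ∘ suc) (f≤g ∘ suc))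

sum-mono-< : (f g : Fin n → ℕ) → (∀ i → f i ≤ g i) → ∀ e → f e < g e → sum f < sum g
sum-mono-< f g f≤g zero    fe<ge = +-mono-<-≤ fe<ge (sum-mono-≤ (f ∘ suc) (g ∘ suc) (f≤g ∘ suc))
sum-mono-< f g f≤g (suc e) fe<ge = +-mono-≤-< (f≤g zero) (sum-mono-< (f ∘ suc) (g ∘ suc) (f≤g ∘ suc) e fe<ge)

≤-sum : (f : Fin n → ℕ) → ∀ i → f i ≤ sum f
≤-sum f zero    = m≤m+n _ _
≤-sum f (suc i) = ≤-trans (≤-sum (f ∘ suc) i) (m≤n+m _ (f zero))

count : {P : Pred (Fin n) ℓ} → Decidable P → ℕ
count P? = sum (λ i → indicator (P? i))

count≤size : {P : Pred (Fin n) ℓ} (P? : Decidable P) → count P? ≤ n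
count≤size {n = n} P? = ≤-trans (sum-mono-≤ _ (λ _ → 1) (indicator≤1 ∘ P?)) (≤-reflexive (ones n))
  where
  ones : ∀ n → sum {n} (λ _ → 1) ≡ n
  ones zero    = refl
  ones (suc n) = cong suc (ones n)

count-witness : {P : Pred (Fin n) ℓ} (P? : Decidable P) → 0 < count P? → ∃ P
count-witness {suc n} P? pos with P? zero
... | yes p = zero , p
... | no _  with count-witness (P? ∘ suc) pos
...   | i , p = suc i , p

count≥1 : {P : Pred (Fin n) ℓ} (P? : Decidable P) → ∀ {i} → P i → 1 ≤ count P?
count≥1 P? {i} p = ≤-trans (≤-reflexive (sym (indicator-yes (P? i) p))) (≤-sum _ i)

count≤1 : {P : Pred (Fin n) ℓ} (P? : Decidable P) → (∀ {i j} → P i → P j → i ≡ j) → count P? ≤ 1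
count≤1 {zero}  P? _      = z≤n
count≤1 {suc n} P? unique with P? zero
... | no _  = count≤1 (P? ∘ suc) (λ p p′ → Fin.suc-injective (unique p p′))
... | yes p = s≤s (≤-reflexive (n≤0⇒n≡0 (≮⇒≥ λ pos →
                contradiction (unique p (proj₂ (count-witness (P? ∘ suc) pos))) λ ())))

module _ {n : ℕ} {ℓ₁ ℓ₂ : Level} {P : Pred (Fin n) ℓ₁} {Q : Pred (Fin n) ℓ₂}
         (P? : Decidable P) (Q? : Decidable Q) where

  count-mono : P ⊆ Q → count P? ≤ count Q?
  count-mono P⊆Q = sum-mono-≤ _ _ (λ i → indicator-mono (P? i) (Q? i) P⊆Q)

  count-mono-< : P ⊆ Q → ∀ {e} → ¬ P e → Q e → count P? < count Q?
  count-mono-< P⊆Q {e} ¬Pe Qe = sum-mono-< _ _ (λ i → indicator-mono (P? i) (Q? i) P⊆Q) e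
    (subst₂ _<_ (sym (indicator-no (P? e) ¬Pe)) (sym (indicator-yes (Q? e) Qe)) (s≤s z≤n))

  count-∪-disjoint : (∀ {i} → P i → Q i → ⊥) → count P? + count Q? ≤ count (P? ∪? Q?)
  count-∪-disjoint disjoint = begin
    count P? + count Q?                                  ≡⟨ ∑-distrib-+ (indicator ∘ P?) (indicator ∘ Q?) ⟨
    sum {n} (λ i → indicator (P? i) + indicator (Q? i))  ≤⟨ sum-mono-≤ _ _ pointwise ⟩
    count (P? ∪? Q?)                                     ∎
    where
    open ≤-Reasoning
    pointwise : ∀ i → indicator (P? i) + indicator (Q? i) ≤ indicator ((P? ∪? Q?) i)
    pointwise i = indicator-⊎-disjoint (P? i) (Q? i) disjoint

  module _ {ℓ₃ : Level} {R : Pred (Fin n) ℓ₃} (R? : Decidable R) where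

    count-∪ : P ⊆ Q ∪ R → count P? ≤ count Q? + count R?
    count-∪ P⊆Q∪R = begin
      count P?                                             ≤⟨ sum-mono-≤ _ _ pointwise ⟩
      sum {n} (λ i → indicator (Q? i) + indicator (R? i))  ≡⟨ ∑-distrib-+ (indicator ∘ Q?) (indicator ∘ R?) ⟩
      count Q? + count R?                                  ∎
      where
      open ≤-Reasoning
      pointwise : ∀ i → indicator (P? i) ≤ indicator (Q? i) + indicator (R? i)
      pointwise i = indicator-⊎ (P? i) (Q? i) (R? i) P⊆Q∪R

count-permute : {P : Pred (Fin n) ℓ} (P? : Decidable P) (σ : Permutation′ n) →
                count P? ≡ count (P? ∘ (σ ⟨$⟩ʳ_))
count-permute P? σ = sum-permute (λ i → indicator (P? i)) σ

count-none : {P : Pred (Fin n) ℓ} (P? : Decidable P) → (∀ i → ¬ P i) → count P? ≡ 0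
count-none P? ¬P = n≤0⇒n≡0 (≮⇒≥ λ pos → ¬P _ (proj₂ (count-witness P? pos)))

count-toℕ< : ∀ {n m} → m ≤ n → count (λ (i : Fin n) → toℕ i <? m) ≡ m
count-toℕ< {zero}  z≤n     = refl
count-toℕ< {suc n} {zero} _ = count-none {suc n} (λ i → toℕ i <? 0) (λ _ ())
count-toℕ< {suc n} {suc m} (s≤s m≤n) = cong suc (begin
  count (λ (i : Fin n) → suc (toℕ i) <? suc m) ≡⟨ sum-cong-≗ {n} (λ i → indicator-cong (suc (toℕ i) <? suc m) (toℕ i <? m) s≤s⁻¹ s≤s) ⟩
  count (λ (i : Fin n) → toℕ i <? m)           ≡⟨ count-toℕ< m≤n ⟩
  m                                            ∎)
  where open ≡-Reasoning

count-≤-matching : ∀ {ℓ₁ ℓ₂ ℓ₃} {P : Pred (Fin m) ℓ₁} {Q : Pred (Fin n) ℓ₂}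
  (P? : Decidable P) (Q? : Decidable Q)
  (R : Fin m → Fin n → Set ℓ₃) (R? : ∀ i j → Dec (R i j)) →
  (∀ {i} → P i → ∃ (R i)) →
  (∀ {i j} → P i → R i j → Q j) →
  (∀ {i i′ j} → R i j → R i′ j → i ≡ i′) →
  count P? ≤ count Q?
count-≤-matching {m} {n} {P = P} P? Q? R R? match R⇒Q unique = begin
  count P?                       ≤⟨ sum-mono-≤ _ _ row ⟩
  sum {m} (λ i → sum {n} (E i))  ≡⟨ ∑-comm E ⟩
  sum {n} (λ j → sum {m} (λ i → E i j)) ≤⟨ sum-mono-≤ _ _ column ⟩
  count Q?                       ∎
  where
  open ≤-Reasoning
  PR? : ∀ i j → Dec (P i × R i j)
  PR? i j = P? i ×-dec R? i j
  E : Fin m → Fin n → ℕ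
  E i j = indicator (PR? i j)
  row : ∀ i → indicator (P? i) ≤ count (PR? i)
  row i = indicator-≤ (P? i) (λ p → count≥1 (PR? i) (p , proj₂ (match p)))
  column : ∀ j → count (λ i → PR? i j) ≤ indicator (Q? j)
  column j = ≤-indicator (Q? j)
    (count≤1 (λ i → PR? i j) (λ (_ , r) (_ , r′) → unique r r′))
    (λ pos → let (_ , p , r) = count-witness (λ i → PR? i j) pos in R⇒Q p r)

last-or-not : (i : Fin (suc m)) → toℕ i < m ⊎ toℕ i ≡ m
last-or-not i = m≤n⇒m<n∨m≡n (s≤s⁻¹ (toℕ<n i))

toℕ-next-< : {i : Fin (suc m)} → toℕ i < m → toℕ (next i) ≡ suc (toℕ i)
toℕ-next-< i<m = trans (toℕ-fromℕ< _) (m<n⇒m%n≡m (s≤s i<m))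

toℕ-next-last : {i : Fin (suc m)} → toℕ i ≡ m → toℕ (next i) ≡ 0
toℕ-next-last {m} eq = trans (toℕ-fromℕ< _) (trans (cong (λ s → suc s % suc m) eq) (n%n≡0 (suc m)))

toℕ-prev-suc : {i : Fin (suc m)} {t : ℕ} → toℕ i ≡ suc t → toℕ (prev i) ≡ t
toℕ-prev-suc {m} {i} {t} eq = begin
  toℕ (prev i)          ≡⟨ toℕ-fromℕ< _ ⟩
  (toℕ i + m) % suc m   ≡⟨ cong (λ s → (s + m) % suc m) eq ⟩
  (suc t + m) % suc m   ≡⟨ cong (_% suc m) (+-suc t m) ⟨
  (t + suc m) % suc m   ≡⟨ [m+n]%n≡m%n t (suc m) ⟩
  t % suc m             ≡⟨ m<n⇒m%n≡m (<-trans (n<1+n t) (subst (_< suc m) eq (toℕ<n i))) ⟩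
  t                     ∎
  where open ≡-Reasoning

toℕ-prev-zero : {i : Fin (suc m)} → toℕ i ≡ 0 → toℕ (prev i) ≡ m
toℕ-prev-zero {m} eq = trans (toℕ-fromℕ< _) (trans (cong (λ s → (s + m) % suc m) eq) (m<n⇒m%n≡m (n<1+n m)))

prev-next : (i : Fin (suc m)) → prev (next i) ≡ i
prev-next {m} i = toℕ-injective (by-position (last-or-not i))
  where
  by-position : toℕ i < m ⊎ toℕ i ≡ m → toℕ (prev (next i)) ≡ toℕ i
  by-position (inj₁ i<m)  = toℕ-prev-suc (toℕ-next-< i<m)
  by-position (inj₂ i≡m) = trans (toℕ-prev-zero (toℕ-next-last i≡m)) (sym i≡m)

next-prev : (i : Fin (suc m)) → next (prev i) ≡ i
next-prev {m} i = toℕ-injective (by-position (toℕ i) refl)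
  where
  by-position : ∀ t → toℕ i ≡ t → toℕ (next (prev i)) ≡ toℕ i
  by-position zero    eq = trans (toℕ-next-last (toℕ-prev-zero eq)) (sym eq)
  by-position (suc t) eq = begin
    toℕ (next (prev i)) ≡⟨ toℕ-next-< (subst (_< m) (sym (toℕ-prev-suc eq)) (s≤s⁻¹ (subst (_< suc m) eq (toℕ<n i)))) ⟩
    suc (toℕ (prev i))  ≡⟨ cong suc (toℕ-prev-suc eq) ⟩
    suc t               ≡⟨ eq ⟨
    toℕ i               ∎
    where open ≡-Reasoning

prev-permutation : Permutation′ (suc m)
prev-permutation = permutation prev next prev-next next-prev

next≢ : (i : Fin (suc (suc m))) → next i ≢ i
next≢ i eq with last-or-not i
... | inj₁ i<m  = 1+n≢n (trans (sym (toℕ-next-< i<m)) (cong toℕ eq))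
... | inj₂ i≡m = 0≢1+n (trans (sym (toℕ-next-last i≡m)) (trans (cong toℕ eq) i≡m))

prev≢ : (i : Fin (suc (suc m))) → prev i ≢ i
prev≢ i eq = next≢ (prev i) (trans (next-prev i) (sym eq))

module _ {m : ℕ} {P : Pred (Fin (suc m)) ℓ} (closed : ∀ {i} → P i → P (next i)) where

  closed-forward : ∀ {i} → P i → ∀ d {j} → toℕ j ≡ toℕ i + d → P j
  closed-forward Pi zero    eq = subst P (toℕ-injective (sym (trans eq (+-identityʳ _)))) Pi
  closed-forward Pi (suc d) {j} eq =
    subst P (next-prev j) (closed (closed-forward Pi d (toℕ-prev-suc (trans eq (+-suc _ d)))))

  closed-everywhere : ∀ {i} → P i → ∀ j → P j
  closed-everywhere {i} Pi j = closed-forward P0 (toℕ j) refl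
    where
    Plast : P (fromℕ m)
    Plast = closed-forward Pi (m ∸ toℕ i) (trans (toℕ-fromℕ m) (sym (m+[n∸m]≡n (s≤s⁻¹ (toℕ<n i)))))
    P0 : P zero
    P0 = subst P (toℕ-injective (toℕ-next-last (toℕ-fromℕ m))) (closed Plast)

injective⇒surjective : {f : Fin n → Fin n} → Injective _≡_ _≡_ f → ∀ y → ∃ λ x → f x ≡ y
injective⇒surjective {suc n} {f} f-injective y with any? (λ x → f x Fin.≟ y)
... | yes hit  = hit
... | no  miss = contradiction (injective⇒≤ avoid-injective) 1+n≰n
  where
  avoid : Fin (suc n) → Fin n
  avoid x = punchOut (λ eq → miss (x , sym eq))
  avoid-injective : Injective _≡_ _≡_ avoid
  avoid-injective {x} {x′} eq = f-injective (punchOut-injective (λ e → miss (x , sym e)) (λ e → miss (x′ , sym e)) eq)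

permutation-from-injection : (f : Fin n → Fin n) → Injective _≡_ _≡_ f → Permutation′ n
permutation-from-injection f f-injective =
  permutation (proj₁ ∘ preimage) f (λ x → f-injective (proj₂ (preimage (f x)))) (proj₂ ∘ preimage)
  where
  preimage = injective⇒surjective f-injective

value-injective : (π : Permutation′ n) → Injective _≡_ _≡_ (value π)
value-injective π {i} {j} eq = begin
  i                      ≡⟨ inverseˡ π ⟨
  π ⟨$⟩ˡ (π ⟨$⟩ʳ i)     ≡⟨ cong (π ⟨$⟩ˡ_) (toℕ-injective (suc-injective eq)) ⟩
  π ⟨$⟩ˡ (π ⟨$⟩ʳ j)     ≡⟨ inverseˡ π ⟩
  j                      ∎
  where open ≡-Reasoning

value≤size : (π : Permutation′ n) (i : Fin n) → value π i ≤ n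
value≤size π i = toℕ<n (π ⟨$⟩ʳ i)

StrictlyIncreasing : Vec ℕ n → Set
StrictlyIncreasing v = ∀ i j → i <ᶠ j → lookup v i < lookup v j

module _ (v : Vec ℕ n) (increasing : StrictlyIncreasing v) where

  increasing-mono : ∀ i j → toℕ i ≤ toℕ j → lookup v i ≤ lookup v j
  increasing-mono i j i≤j with m≤n⇒m<n∨m≡n i≤j
  ... | inj₁ i<j = <⇒≤ (increasing i j i<j)
  ... | inj₂ i≡j = ≤-reflexive (cong (lookup v) (toℕ-injective i≡j))

  increasing-reflects-< : ∀ i j → lookup v i < lookup v j → i <ᶠ j
  increasing-reflects-< i j vi<vj = ≰⇒> (λ j≤i → <⇒≱ vi<vj (increasing-mono j i j≤i))

  increasing-injective : Injective _≡_ _≡_ (lookup v)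
  increasing-injective {i} {j} eq with <-cmp (toℕ i) (toℕ j)
  ... | tri< i<j _ _ = contradiction eq (<⇒≢ (increasing i j i<j))
  ... | tri≈ _ i≡j _ = toℕ-injective i≡j
  ... | tri> _ _ j<i = contradiction (sym eq) (<⇒≢ (increasing j i j<i))

module Crossing {m : ℕ} (a : Fin (suc (suc m)) → ℕ) (a-injective : Injective _≡_ _≡_ a) (x : ℕ) where

  Low : Pred (Fin (suc (suc m))) 0ℓ
  Low i = a i ≤ x

  low? : Decidable Low
  low? i = a i ≤? x

  LowPinnacle LowVale DescentFromLow DescentToLow LowInsideDescent : Pred (Fin (suc (suc m))) 0ℓ
  LowPinnacle i      = Low i × a (prev i) < a i × a (next i) < a i
  LowVale i          = Low i × a i < a (prev i) × a i < a (next i)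
  DescentFromLow i   = Low i × a (next i) < a i
  DescentToLow i     = Low (next i) × a (next i) < a i
  LowInsideDescent i = Low i × a i < a (prev i) × a (next i) < a i

  lowPinnacle? : Decidable LowPinnacle
  lowPinnacle? i = low? i ×-dec (a (prev i) <? a i) ×-dec (a (next i) <? a i)

  lowVale? : Decidable LowVale
  lowVale? i = low? i ×-dec (a i <? a (prev i)) ×-dec (a i <? a (next i))

  descentFromLow? : Decidable DescentFromLow
  descentFromLow? i = low? i ×-dec (a (next i) <? a i)

  descentToLow? : Decidable DescentToLow
  descentToLow? i = low? (next i) ×-dec (a (next i) <? a i)

  lowInsideDescent? : Decidable LowInsideDescent
  lowInsideDescent? i = low? i ×-dec (a i <? a (prev i)) ×-dec (a (next i) <? a i)

  entry-point : ∃ Low → ∃ (∁ Low) → ∃ λ e → ¬ Low e × Low (next e)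
  entry-point (i , low) (j , high) with any? (λ e → ¬? (low? e) ×-dec low? (next e))
  ... | yes found = found
  ... | no none   = ⊥-elim (closed-everywhere {P = ∁ Low} high-closed high i low)
    where
    high-closed : ∀ {e} → ¬ Low e → ¬ Low (next e)
    high-closed {e} high-e low-next = none (e , high-e , low-next)

  lowPinnacles<lowVales : ∃ Low → ∃ (∁ Low) → count lowPinnacle? < count lowVale?
  lowPinnacles<lowVales low high with entry-point low high
  ... | e , high-e , low-next = +-cancelʳ-< (count lowInsideDescent?) _ _ (begin-strict
    count lowPinnacle? + count lowInsideDescent?  ≤⟨ count-∪-disjoint lowPinnacle? lowInsideDescent? (λ (_ , p , _) (_ , v , _) → <-asym p v) ⟩
    count (lowPinnacle? ∪? lowInsideDescent?)     ≤⟨ count-mono (lowPinnacle? ∪? lowInsideDescent?) descentFromLow? starts-descent ⟩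
    count descentFromLow?                         <⟨ count-mono-< descentFromLow? descentToLow? ends-low (λ (l , _) → high-e l) entering ⟩
    count descentToLow?                           ≡⟨ count-permute descentToLow? prev-permutation ⟩
    count (descentToLow? ∘ prev)                  ≤⟨ count-∪ (descentToLow? ∘ prev) lowVale? lowInsideDescent? vale-or-inside ⟩
    count lowVale? + count lowInsideDescent?      ∎)
    where
    open ≤-Reasoning
    starts-descent : LowPinnacle ∪ LowInsideDescent ⊆ DescentFromLow
    starts-descent (inj₁ (l , _ , d)) = l , d
    starts-descent (inj₂ (l , _ , d)) = l , d
    ends-low : DescentFromLow ⊆ DescentToLow
    ends-low (l , d) = ≤-trans (<⇒≤ d) l , d
    entering : DescentToLow e
    entering = low-next , ≤-<-trans low-next (≰⇒> high-e)
    vale-or-inside : ∀ {i} → DescentToLow (prev i) → LowVale i ⊎ LowInsideDescent i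
    vale-or-inside {i} d with subst (λ j → Low j × a j < a (prev i)) (next-prev i) d
    ... | l , below-prev with a (next i) <? a i
    ... | yes next-below = inj₂ (l , below-prev , next-below)
    ... | no  next-above = inj₁ (l , below-prev , ≤∧≢⇒< (≮⇒≥ next-above) (next≢ i ∘ a-injective ∘ sym))

module Necessity {k m : ℕ} (q w : Vec ℕ k)
  (q-increasing : StrictlyIncreasing q) (w-increasing : StrictlyIncreasing w)
  (π : Permutation′ (suc (suc m)))
  (pinnacles : ∀ x → IsPinnacle π x ⇔ (x ∈ q ⊎ x ≡ suc (suc m)))
  (vales : ∀ x → IsVale π x ⇔ (x ∈ w ⊎ x ≡ 1))
  (j : Fin k) (qⱼ<n : lookup q j < suc (suc m)) (qⱼ<wⱼ : lookup q j < lookup w j) where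

  open Crossing (value π) (value-injective π) (lookup q j)

  pinnacle-at : ∀ t → IsPinnacle π (lookup q t)
  pinnacle-at t = Equivalence.from (pinnacles _) (inj₁ (∈-lookup t q))

  upTo-j? : ∀ {n} → Decidable (λ (t : Fin n) → toℕ t < suc (toℕ j))
  upTo-j? t = toℕ t <? suc (toℕ j)

  lowPinnacles≥ : suc (toℕ j) ≤ count lowPinnacle?
  lowPinnacles≥ = begin
    suc (toℕ j)         ≡⟨ count-toℕ< (toℕ<n j) ⟨
    count (upTo-j? {k}) ≤⟨ count-≤-matching upTo-j? lowPinnacle? R (λ t i → value π i ≟ lookup q t) match low-pinnacle
                             (λ e e′ → increasing-injective q q-increasing (trans (sym e) e′)) ⟩
    count lowPinnacle?  ∎
    where
    open ≤-Reasoning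
    R : Fin k → Fin (suc (suc m)) → Set
    R t i = value π i ≡ lookup q t
    match : ∀ {t} → toℕ t < suc (toℕ j) → ∃ (R t)
    match {t} _ = let (i , e , _) = pinnacle-at t in i , e
    low-pinnacle : ∀ {t i} → toℕ t < suc (toℕ j) → R t i → LowPinnacle i
    low-pinnacle {t} {i} t≤j e with pinnacle-at t
    ... | i′ , e′ , up , down with value-injective π (trans e′ (sym e))
    ... | refl = subst (_≤ lookup q j) (sym e) (increasing-mono q q-increasing t j (s≤s⁻¹ t≤j)) , up , down

  lowVales≤ : count lowVale? ≤ suc (toℕ j)
  lowVales≤ = begin
    count lowVale?            ≤⟨ count-≤-matching lowVale? upTo-j? R (λ i t → value π i ≟ lookup (1 ∷ w) t) match index-below
                                   (λ r r′ → value-injective π (trans r (sym r′))) ⟩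
    count (upTo-j? {suc k})   ≡⟨ count-toℕ< (s≤s (<⇒≤ (toℕ<n j))) ⟩
    suc (toℕ j)               ∎
    where
    open ≤-Reasoning
    R : Fin (suc (suc m)) → Fin (suc k) → Set
    R i t = value π i ≡ lookup (1 ∷ w) t
    match : ∀ {i} → LowVale i → ∃ (R i)
    match {i} (_ , down , up) with Equivalence.to (vales _) (i , refl , down , up)
    ... | inj₁ ∈w = suc (index ∈w) , lookup-index ∈w
    ... | inj₂ ≡1 = zero , ≡1
    index-below : ∀ {i t} → LowVale i → R i t → toℕ t < suc (toℕ j)
    index-below {t = zero}  _         _ = s≤s z≤n
    index-below {t = suc t} (low , _) e =
      s≤s (increasing-reflects-< w w-increasing t j (≤-<-trans (subst (_≤ lookup q j) e low) qⱼ<wⱼ))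

  absurd : ⊥
  absurd = <⇒≱ (lowPinnacles<lowVales low high) (≤-trans lowVales≤ lowPinnacles≥)
    where
    low : ∃ Low
    low = let (i , e , _) = pinnacle-at j in i , ≤-reflexive e
    high : ∃ (∁ Low)
    high = let (i , e , _) = Equivalence.from (pinnacles _) (inj₂ refl) in i , <⇒≱ (subst (lookup q j <_) (sym e) qⱼ<n)

interlacing-necessary : ∀ {k} (q w : Vec ℕ k) →
  StrictlyIncreasing q → StrictlyIncreasing w → (∀ i → 2 ≤ lookup q i) → (∀ i j → lookup q i ≢ lookup w j) →
  Admissible (_∈ q) (_∈ w) → ∀ j → lookup w j < lookup q j
interlacing-necessary q w q-inc w-inc q≥2 q≢w (zero , q<n , _) j = contradiction (q<n _ (∈-lookup j q)) λ ()
interlacing-necessary q w q-inc w-inc q≥2 q≢w (suc zero , q<n , _) j =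
  contradiction (q<n _ (∈-lookup j q)) (<⇒≱ (≤-trans (s≤s z≤n) (q≥2 j)) ∘ s≤s⁻¹)
interlacing-necessary q w q-inc w-inc q≥2 q≢w (suc (suc m) , q<n , π , pinnacles , vales) j with lookup w j <? lookup q j
... | yes wⱼ<qⱼ = wⱼ<qⱼ
... | no  wⱼ≮qⱼ = ⊥-elim (Necessity.absurd q w q-inc w-inc π pinnacles vales j (q<n _ (∈-lookup j q))
                           (≤∧≢⇒< (≮⇒≥ wⱼ≮qⱼ) (q≢w j j)))

fin-with-toℕ : ∀ {s} → s < n → Σ (Fin n) λ t → toℕ t ≡ s
fin-with-toℕ s<n = fromℕ< s<n , toℕ-fromℕ< s<n

odd<double : ∀ {a b} → a < b → suc (2 * a) < 2 * b
odd<double {a} {b} a<b = ≤-trans (≤-reflexive (sym (*-suc 2 a))) (*-monoʳ-≤ 2 a<b)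

module Construction {k : ℕ} (q w : Vec ℕ k)
  (q-increasing : StrictlyIncreasing q) (w-increasing : StrictlyIncreasing w)
  (q≥2 : ∀ t → 2 ≤ lookup q t) (w≥2 : ∀ t → 2 ≤ lookup w t)
  (q≢w : ∀ t t′ → lookup q t ≢ lookup w t′)
  (w<q : ∀ t → lookup w t < lookup q t) where

  -- Any N > max q works; this one is easy to bound.
  M N : ℕ
  M = sum (lookup q)
  N = suc (suc M)

  q<N : ∀ t → lookup q t < N
  q<N t = s≤s (m≤n⇒m≤1+n (≤-sum (lookup q) t))

  w<N : ∀ t → lookup w t < N
  w<N t = <-trans (w<q t) (q<N t)

  ⟦_⟧ : Fin N → ℕ
  ⟦ u ⟧ = suc (toℕ u)

  ⟦⟧-injective : ∀ {u v} → ⟦ u ⟧ ≡ ⟦ v ⟧ → u ≡ v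
  ⟦⟧-injective = toℕ-injective ∘ suc-injective

  index-of : ∀ {y} → 1 ≤ y → y ≤ N → ∃ λ u → ⟦ u ⟧ ≡ y
  index-of {suc y} _ y<N = let (u , e) = fin-with-toℕ y<N in u , cong suc e

  Bottom Top Peak Valley Special Filler : Pred (Fin N) 0ℓ
  Bottom u = ⟦ u ⟧ ≡ 1
  Top u    = ⟦ u ⟧ ≡ N
  Peak u   = ∃ λ t → lookup q t ≡ ⟦ u ⟧
  Valley u = ∃ λ t → lookup w t ≡ ⟦ u ⟧
  Special  = Bottom ∪ Top ∪ Peak ∪ Valley
  Filler   = ∁ Special

  pattern bottom e   = inj₁ e
  pattern top e      = inj₂ (inj₁ e)
  pattern peak t e   = inj₂ (inj₂ (inj₁ (t , e)))
  pattern valley t e = inj₂ (inj₂ (inj₂ (t , e)))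

  bottom? : Decidable Bottom
  bottom? u = ⟦ u ⟧ ≟ 1

  top? : Decidable Top
  top? u = ⟦ u ⟧ ≟ N

  peak? : Decidable Peak
  peak? u = any? λ t → lookup q t ≟ ⟦ u ⟧

  valley? : Decidable Valley
  valley? u = any? λ t → lookup w t ≟ ⟦ u ⟧

  special? : Decidable Special
  special? = bottom? ∪? top? ∪? peak? ∪? valley?

  filler? : Decidable Filler
  filler? = ∁? special?

  q≢1 : ∀ t → lookup q t ≢ 1
  q≢1 t e = <⇒≱ (q≥2 t) (≤-reflexive e)

  w≢1 : ∀ t → lookup w t ≢ 1
  w≢1 t e = <⇒≱ (w≥2 t) (≤-reflexive e)

  q≢N : ∀ t → lookup q t ≢ N
  q≢N t = <⇒≢ (q<N t)

  w≢N : ∀ t → lookup w t ≢ N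
  w≢N t = <⇒≢ (w<N t)

  top-index : ∃ Top
  top-index = fromℕ (suc M) , cong suc (toℕ-fromℕ (suc M))

  peak-index : ∀ t → ∃ λ u → lookup q t ≡ ⟦ u ⟧
  peak-index t = let (u , e) = index-of (≤-trans (s≤s z≤n) (q≥2 t)) (<⇒≤ (q<N t)) in u , sym e

  valley-index : ∀ t → ∃ λ u → lookup w t ≡ ⟦ u ⟧
  valley-index t = let (u , e) = index-of (≤-trans (s≤s z≤n) (w≥2 t)) (<⇒≤ (w<N t)) in u , sym e

  occurrences≥ : (v : Vec ℕ k) → Injective _≡_ _≡_ (lookup v) → (∀ t → ∃ λ u → lookup v t ≡ ⟦ u ⟧) →
                 k ≤ count (λ u → any? λ t → lookup v t ≟ ⟦ u ⟧)
  occurrences≥ v v-injective indices = begin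
    k                                               ≡⟨ count-toℕ< ≤-refl ⟨
    count (λ (t : Fin k) → toℕ t <? k)              ≤⟨ count-≤-matching (λ t → toℕ t <? k) occurs? R R?
                                                         (λ {t} _ → indices t) (λ {t} _ e → t , e) (λ e e′ → v-injective (trans e (sym e′))) ⟩
    count occurs?                                   ∎
    where
    open ≤-Reasoning
    occurs? : Decidable (λ u → ∃ λ t → lookup v t ≡ ⟦ u ⟧)
    occurs? u = any? λ t → lookup v t ≟ ⟦ u ⟧
    R : Fin k → Fin N → Set
    R t u = lookup v t ≡ ⟦ u ⟧
    R? : ∀ t u → Dec (R t u)
    R? t u = lookup v t ≟ ⟦ u ⟧

  specials≥ : 2 + 2 * k ≤ count special?
  specials≥ = begin
    2 + 2 * k                                         ≤⟨ +-mono-≤ (count≥1 bottom? {zero} refl) (+-mono-≤ (count≥1 top? (proj₂ top-index))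
                                                           (+-mono-≤ peaks≥ (≤-trans (≤-reflexive (+-identityʳ k)) valleys≥))) ⟩
    count bottom? + (count top? + (count peak? + count valley?))
                                                      ≤⟨ +-monoʳ-≤ (count bottom?) (+-monoʳ-≤ (count top?)
                                                           (count-∪-disjoint peak? valley? peak-valley-disjoint)) ⟩
    count bottom? + (count top? + count (peak? ∪? valley?))
                                                      ≤⟨ +-monoʳ-≤ (count bottom?) (count-∪-disjoint top? (peak? ∪? valley?) top-disjoint) ⟩
    count bottom? + count (top? ∪? peak? ∪? valley?)  ≤⟨ count-∪-disjoint bottom? (top? ∪? peak? ∪? valley?) bottom-disjoint ⟩
    count special?                                    ∎
    where
    open ≤-Reasoning
    peaks≥ : k ≤ count peak?
    peaks≥ = occurrences≥ q (increasing-injective q q-increasing) peak-index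
    valleys≥ : k ≤ count valley?
    valleys≥ = occurrences≥ w (increasing-injective w w-increasing) valley-index
    peak-valley-disjoint : ∀ {u} → Peak u → Valley u → ⊥
    peak-valley-disjoint (t , e) (t′ , e′) = q≢w t t′ (trans e (sym e′))
    top-disjoint : ∀ {u} → Top u → (Peak ∪ Valley) u → ⊥
    top-disjoint e (inj₁ (t , e′)) = q≢N t (trans e′ e)
    top-disjoint e (inj₂ (t , e′)) = w≢N t (trans e′ e)
    bottom-disjoint : ∀ {u} → Bottom u → (Top ∪ Peak ∪ Valley) u → ⊥
    bottom-disjoint e (inj₁ e′)               = contradiction (trans (sym e) e′) λ ()
    bottom-disjoint e (inj₂ (inj₁ (t , e′))) = q≢1 t (trans e′ e)
    bottom-disjoint e (inj₂ (inj₂ (t , e′))) = w≢1 t (trans e′ e)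

  fillers-fit : 2 * k + count filler? ≤ M
  fillers-fit = s≤s⁻¹ (s≤s⁻¹ (begin
    2 + 2 * k + count filler?       ≤⟨ +-monoˡ-≤ (count filler?) specials≥ ⟩
    count special? + count filler?  ≡⟨ +-comm (count special?) (count filler?) ⟩
    count filler? + count special?  ≤⟨ count-∪-disjoint filler? special? (λ filler special → filler special) ⟩
    count (filler? ∪? special?)     ≤⟨ count≤size (filler? ∪? special?) ⟩
    N                               ∎))
    where open ≤-Reasoning

  rank : Fin N → ℕ
  rank u = count (λ v → (u <ᶠ? v) ×-dec filler? v)

  rank-antitone : ∀ {u v} → Filler v → u <ᶠ v → rank v < rank u
  rank-antitone {u} {v} filler-v u<v =
    count-mono-< (λ x → (v <ᶠ? x) ×-dec filler? x) (λ x → (u <ᶠ? x) ×-dec filler? x)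
      (λ (v<x , filler-x) → <-trans u<v v<x , filler-x) (λ (v<v , _) → <-irrefl refl v<v) (u<v , filler-v)

  rank<fillers : ∀ {u} → Filler u → rank u < count filler?
  rank<fillers {u} filler-u =
    count-mono-< (λ x → (u <ᶠ? x) ×-dec filler? x) filler? proj₂ (λ (u<u , _) → <-irrefl refl u<u) filler-u

  rank-injective : ∀ {u v} → Filler u → Filler v → rank u ≡ rank v → u ≡ v
  rank-injective {u} {v} filler-u filler-v eq with <-cmp (toℕ u) (toℕ v)
  ... | tri< u<v _ _ = contradiction (sym eq) (<⇒≢ (rank-antitone filler-v u<v))
  ... | tri≈ _ u≡v _ = toℕ-injective u≡v
  ... | tri> _ _ v<u = contradiction eq (<⇒≢ (rank-antitone filler-u v<u))

  rank-reflects-< : ∀ {u v} → Filler u → Filler v → rank u < rank v → v <ᶠ u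
  rank-reflects-< {u} {v} filler-u filler-v ru<rv =
    ≤∧≢⇒< (≮⇒≥ λ u<v → <-asym ru<rv (rank-antitone filler-v u<v)) λ v≡u → <-irrefl (cong rank (toℕ-injective (sym v≡u))) ru<rv

  -- Cyclic layout: q₀ w₀ q₁ w₁ … q₍ₖ₋₁₎ w₍ₖ₋₁₎ N, then the fillers in decreasing order, then 1.
  slot : ∀ {u} → Special u → ℕ
  slot (bottom _)   = suc M
  slot (top _)      = 2 * k
  slot (peak t _)   = 2 * toℕ t
  slot (valley t _) = suc (2 * toℕ t)

  filler-slot : Fin N → ℕ
  filler-slot u = suc (2 * k + rank u)

  peak-slot< : ∀ (t : Fin k) → 2 * toℕ t < 2 * k
  peak-slot< t = *-monoʳ-< 2 (toℕ<n t)

  valley-slot< : ∀ (t : Fin k) → suc (2 * toℕ t) < 2 * k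
  valley-slot< t = odd<double (toℕ<n t)

  top-slot<bottom-slot : 2 * k < suc M
  top-slot<bottom-slot = s≤s (≤-trans (m≤m+n _ _) fillers-fit)

  top-slot<filler-slot : ∀ u → 2 * k < filler-slot u
  top-slot<filler-slot u = s≤s (m≤m+n _ _)

  filler-slot<bottom-slot : ∀ {u} → Filler u → filler-slot u < suc M
  filler-slot<bottom-slot filler-u = s≤s (<-≤-trans (+-monoʳ-< (2 * k) (rank<fillers filler-u)) fillers-fit)

  slot-unique : ∀ {u} (s s′ : Special u) → slot s ≡ slot s′
  slot-unique (bottom _)   (bottom _)     = refl
  slot-unique (bottom e)   (top e′)       = contradiction (trans (sym e) e′) λ ()
  slot-unique (bottom e)   (peak t e′)    = contradiction (trans e′ e) (q≢1 t)
  slot-unique (bottom e)   (valley t e′)  = contradiction (trans e′ e) (w≢1 t)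
  slot-unique (top e)      (bottom e′)    = contradiction (trans (sym e′) e) λ ()
  slot-unique (top _)      (top _)        = refl
  slot-unique (top e)      (peak t e′)    = contradiction (trans e′ e) (q≢N t)
  slot-unique (top e)      (valley t e′)  = contradiction (trans e′ e) (w≢N t)
  slot-unique (peak t e)   (bottom e′)    = contradiction (trans e e′) (q≢1 t)
  slot-unique (peak t e)   (top e′)       = contradiction (trans e e′) (q≢N t)
  slot-unique (peak t e)   (peak t′ e′)   = cong (λ t → 2 * toℕ t) (increasing-injective q q-increasing (trans e (sym e′)))
  slot-unique (peak t e)   (valley t′ e′) = contradiction (trans e (sym e′)) (q≢w t t′)
  slot-unique (valley t e) (bottom e′)    = contradiction (trans e e′) (w≢1 t)
  slot-unique (valley t e) (top e′)       = contradiction (trans e e′) (w≢N t)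
  slot-unique (valley t e) (peak t′ e′)   = contradiction (trans e′ (sym e)) (q≢w t′ t)
  slot-unique (valley t e) (valley t′ e′) =
    cong (λ t → suc (2 * toℕ t)) (increasing-injective w w-increasing (trans e (sym e′)))

  slot-injective : ∀ {u v} (s : Special u) (s′ : Special v) → slot s ≡ slot s′ → u ≡ v
  slot-injective (bottom e)   (bottom e′)    _  = ⟦⟧-injective (trans e (sym e′))
  slot-injective (bottom _)   (top _)        eq = contradiction (sym eq) (<⇒≢ top-slot<bottom-slot)
  slot-injective (bottom _)   (peak t _)     eq = contradiction (sym eq) (<⇒≢ (<-trans (peak-slot< t) top-slot<bottom-slot))
  slot-injective (bottom _)   (valley t _)   eq = contradiction (sym eq) (<⇒≢ (<-trans (valley-slot< t) top-slot<bottom-slot))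
  slot-injective (top _)      (bottom _)     eq = contradiction eq (<⇒≢ top-slot<bottom-slot)
  slot-injective (top e)      (top e′)       _  = ⟦⟧-injective (trans e (sym e′))
  slot-injective (top _)      (peak t _)     eq = contradiction (sym eq) (<⇒≢ (peak-slot< t))
  slot-injective (top _)      (valley t _)   eq = contradiction (sym eq) (<⇒≢ (valley-slot< t))
  slot-injective (peak t _)   (bottom _)     eq = contradiction eq (<⇒≢ (<-trans (peak-slot< t) top-slot<bottom-slot))
  slot-injective (peak t _)   (top _)        eq = contradiction eq (<⇒≢ (peak-slot< t))
  slot-injective (peak t e)   (peak t′ e′)   eq =
    ⟦⟧-injective (trans (sym e) (trans (cong (lookup q) (toℕ-injective (*-cancelˡ-≡ _ _ 2 eq))) e′))
  slot-injective (peak t _)   (valley t′ _)  eq = contradiction eq (even≢odd (toℕ t) (toℕ t′))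
  slot-injective (valley t _) (bottom _)     eq = contradiction eq (<⇒≢ (<-trans (valley-slot< t) top-slot<bottom-slot))
  slot-injective (valley t _) (top _)        eq = contradiction eq (<⇒≢ (valley-slot< t))
  slot-injective (valley t _) (peak t′ _)    eq = contradiction (sym eq) (even≢odd (toℕ t′) (toℕ t))
  slot-injective (valley t e) (valley t′ e′) eq =
    ⟦⟧-injective (trans (sym e) (trans (cong (lookup w) (toℕ-injective (*-cancelˡ-≡ _ _ 2 (suc-injective eq)))) e′))

  slot≢filler-slot : ∀ {u v} (s : Special u) → Filler v → slot s ≢ filler-slot v
  slot≢filler-slot (bottom _)   filler-v = ≢-sym (<⇒≢ (filler-slot<bottom-slot filler-v))
  slot≢filler-slot {v = v} (top _)      _ = <⇒≢ (top-slot<filler-slot v)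
  slot≢filler-slot {v = v} (peak t _)   _ = <⇒≢ (<-trans (peak-slot< t) (top-slot<filler-slot v))
  slot≢filler-slot {v = v} (valley t _) _ = <⇒≢ (<-trans (valley-slot< t) (top-slot<filler-slot v))

  position′ : ∀ u → Dec (Special u) → ℕ
  position′ u (yes s) = slot s
  position′ u (no _)  = filler-slot u

  position : Fin N → ℕ
  position u = position′ u (special? u)

  position-special : ∀ {u} (s : Special u) → position u ≡ slot s
  position-special {u} s with special? u
  ... | yes s′ = slot-unique s′ s
  ... | no ¬s  = contradiction s ¬s

  position-filler : ∀ {u} → Filler u → position u ≡ filler-slot u
  position-filler {u} filler-u with special? u
  ... | yes s = contradiction s filler-u
  ... | no _  = refl

  position<N : ∀ u → position u < N
  position<N u with special? u
  ... | yes (bottom _)   = ≤-refl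
  ... | yes (top _)      = <-trans top-slot<bottom-slot (n<1+n _)
  ... | yes (peak t _)   = <-trans (<-trans (peak-slot< t) top-slot<bottom-slot) (n<1+n _)
  ... | yes (valley t _) = <-trans (<-trans (valley-slot< t) top-slot<bottom-slot) (n<1+n _)
  ... | no filler-u      = <-trans (filler-slot<bottom-slot filler-u) (n<1+n _)

  position-injective : ∀ {u v} → position u ≡ position v → u ≡ v
  position-injective {u} {v} with special? u | special? v
  ... | yes s      | yes s′      = slot-injective s s′
  ... | yes s      | no filler-v = ⊥-elim ∘ slot≢filler-slot s filler-v
  ... | no filler-u | yes s′     = ⊥-elim ∘ slot≢filler-slot s′ filler-u ∘ sym
  ... | no filler-u | no filler-v = rank-injective filler-u filler-v ∘ +-cancelˡ-≡ (2 * k) _ _ ∘ suc-injective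

  place : Fin N → Fin N
  place u = fromℕ< (position<N u)

  toℕ-place : ∀ u → toℕ (place u) ≡ position u
  toℕ-place u = toℕ-fromℕ< (position<N u)

  place-injective : Injective _≡_ _≡_ place
  place-injective {u} {v} eq = position-injective (trans (sym (toℕ-place u)) (trans (cong toℕ eq) (toℕ-place v)))

  -- Abstract: unfolding the inverse, which is found by exhaustive search, makes checking blow up.
  abstract
    layout : Permutation′ N
    layout = permutation-from-injection place place-injective

    layout-place : ∀ u → layout ⟨$⟩ˡ u ≡ place u
    layout-place _ = refl

  at : Fin N → ℕ
  at = value layout

  position-at : ∀ p → position (layout ⟨$⟩ʳ p) ≡ toℕ p
  position-at p = begin
    position (layout ⟨$⟩ʳ p)             ≡⟨ toℕ-place (layout ⟨$⟩ʳ p) ⟨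
    toℕ (place (layout ⟨$⟩ʳ p))          ≡⟨ cong toℕ (layout-place (layout ⟨$⟩ʳ p)) ⟨
    toℕ (layout ⟨$⟩ˡ (layout ⟨$⟩ʳ p))   ≡⟨ cong toℕ (inverseˡ layout) ⟩
    toℕ p                                ∎
    where open ≡-Reasoning

  occurrence : ∀ u → ∃ λ p → at p ≡ ⟦ u ⟧ × toℕ p ≡ position u
  occurrence u = layout ⟨$⟩ˡ u , cong ⟦_⟧ (inverseʳ layout) , trans (cong toℕ (layout-place u)) (toℕ-place u)

  at-slot : ∀ {u p} (s : Special u) → toℕ p ≡ slot s → at p ≡ ⟦ u ⟧
  at-slot {p = p} s eq = cong ⟦_⟧ (position-injective (trans (position-at p) (trans eq (sym (position-special s)))))

  at-peak-slot : ∀ {p t} → toℕ p ≡ 2 * toℕ t → at p ≡ lookup q t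
  at-peak-slot {t = t} eq = let (_ , e) = peak-index t in trans (at-slot (peak t e) eq) (sym e)

  at-valley-slot : ∀ {p t} → toℕ p ≡ suc (2 * toℕ t) → at p ≡ lookup w t
  at-valley-slot {t = t} eq = let (_ , e) = valley-index t in trans (at-slot (valley t e) eq) (sym e)

  at-top-slot : ∀ {p} → toℕ p ≡ 2 * k → at p ≡ N
  at-top-slot eq = let (_ , e) = top-index in trans (at-slot (top e) eq) e

  at-bottom-slot : ∀ {p} → toℕ p ≡ suc M → at p ≡ 1
  at-bottom-slot eq = at-slot {u = zero} (bottom refl) eq

  after-peak : ∀ {p t} → toℕ p ≡ 2 * toℕ t → at (next p) ≡ lookup w t
  after-peak {t = t} eq = at-valley-slot (trans (toℕ-next-< p<) (cong suc eq))
    where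
    p< = subst (_< suc M) (sym eq) (<-trans (peak-slot< t) top-slot<bottom-slot)

  before-peak : ∀ {p t} → toℕ p ≡ 2 * toℕ t → at (prev p) < lookup q t
  before-peak {p} {t} eq with toℕ t in et
  ... | zero  = subst (_< lookup q t) (sym (at-bottom-slot (toℕ-prev-zero eq))) (q≥2 t)
  ... | suc s = subst (_< lookup q t) (sym (at-valley-slot prev-pos))
                  (<-trans (w<q t′) (q-increasing t′ t (subst₂ _<_ (sym e′) (sym et) (n<1+n s))))
    where
    t′ = proj₁ (fin-with-toℕ (<-trans (n<1+n s) (subst (_< k) et (toℕ<n t))))
    e′ = proj₂ (fin-with-toℕ (<-trans (n<1+n s) (subst (_< k) et (toℕ<n t))))
    prev-pos : toℕ (prev p) ≡ suc (2 * toℕ t′)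
    prev-pos = trans (toℕ-prev-suc (trans eq (*-suc 2 s))) (cong (λ x → suc (2 * x)) (sym e′))

  before-valley : ∀ {p t} → toℕ p ≡ suc (2 * toℕ t) → at (prev p) ≡ lookup q t
  before-valley eq = at-peak-slot (toℕ-prev-suc eq)

  after-valley : ∀ {p t} → toℕ p ≡ suc (2 * toℕ t) → lookup w t < at (next p)
  after-valley {p} {t} eq = by-successor (m≤n⇒m<n∨m≡n (toℕ<n t))
    where
    next-pos : toℕ (next p) ≡ 2 * suc (toℕ t)
    next-pos = trans (toℕ-next-< (subst (_< suc M) (sym eq) (<-trans (valley-slot< t) top-slot<bottom-slot)))
                     (trans (cong suc eq) (sym (*-suc 2 (toℕ t))))
    by-successor : suc (toℕ t) < k ⊎ suc (toℕ t) ≡ k → lookup w t < at (next p)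
    by-successor (inj₁ t+1<k) = let (t′ , e′) = fin-with-toℕ t+1<k in
      subst (lookup w t <_) (sym (at-peak-slot (trans next-pos (cong (2 *_) (sym e′)))))
        (<-trans (w<q t) (q-increasing t t′ (subst (toℕ t <_) (sym e′) (n<1+n _))))
    by-successor (inj₂ t+1≡k) = subst (lookup w t <_) (sym (at-top-slot (trans next-pos (cong (2 *_) t+1≡k)))) (w<N t)

  before-filler : ∀ {p u} → Filler u → toℕ p ≡ filler-slot u → ⟦ u ⟧ < at (prev p)
  before-filler {p} {u} filler-u eq = by-kind (special? v) (trans (position-at (prev p)) (toℕ-prev-suc eq))
    where
    v = layout ⟨$⟩ʳ prev p
    by-slot : (s : Special v) → slot s ≡ 2 * k + rank u → ⟦ u ⟧ < ⟦ v ⟧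
    by-slot (bottom _)   eq′ = contradiction (sym eq′) (<⇒≢ (<-trans (n<1+n _) (filler-slot<bottom-slot filler-u)))
    by-slot (top e)      _   = subst (⟦ u ⟧ <_) (sym e) (≤∧≢⇒< (toℕ<n u) (filler-u ∘ top))
    by-slot (peak t _)   eq′ = contradiction eq′ (<⇒≢ (<-≤-trans (peak-slot< t) (m≤m+n _ _)))
    by-slot (valley t _) eq′ = contradiction eq′ (<⇒≢ (<-≤-trans (valley-slot< t) (m≤m+n _ _)))
    by-kind : Dec (Special v) → position v ≡ 2 * k + rank u → ⟦ u ⟧ < ⟦ v ⟧
    by-kind (yes s)        pos = by-slot s (trans (sym (position-special s)) pos)
    by-kind (no filler-v) pos = s≤s (rank-reflects-< filler-v filler-u (≤-reflexive
      (+-cancelˡ-≡ (2 * k) _ _ (trans (+-suc (2 * k) (rank v)) (trans (sym (position-filler filler-v)) pos)))))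

  after-filler : ∀ {p u} → Filler u → toℕ p ≡ filler-slot u → at (next p) < ⟦ u ⟧
  after-filler {p} {u} filler-u eq = by-kind (special? v)
    (trans (position-at (next p)) (trans (toℕ-next-< (subst (_< suc M) (sym eq) (filler-slot<bottom-slot filler-u))) (cong suc eq)))
    where
    v = layout ⟨$⟩ʳ next p
    by-slot : (s : Special v) → slot s ≡ suc (filler-slot u) → ⟦ v ⟧ < ⟦ u ⟧
    by-slot (bottom e)   _   = subst (_< ⟦ u ⟧) (sym e) (≤∧≢⇒< (s≤s z≤n) (filler-u ∘ bottom ∘ sym))
    by-slot (top _)      eq′ = contradiction eq′ (<⇒≢ (<-trans (top-slot<filler-slot u) (n<1+n _)))
    by-slot (peak t _)   eq′ = contradiction eq′ (<⇒≢ (<-trans (<-trans (peak-slot< t) (top-slot<filler-slot u)) (n<1+n _)))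
    by-slot (valley t _) eq′ = contradiction eq′ (<⇒≢ (<-trans (<-trans (valley-slot< t) (top-slot<filler-slot u)) (n<1+n _)))
    by-kind : Dec (Special v) → position v ≡ suc (filler-slot u) → ⟦ v ⟧ < ⟦ u ⟧
    by-kind (yes s)        pos = by-slot s (trans (sym (position-special s)) pos)
    by-kind (no filler-v) pos = s≤s (rank-reflects-< filler-u filler-v (≤-reflexive
      (sym (+-cancelˡ-≡ (2 * k) _ _ (trans (suc-injective (trans (sym (position-filler filler-v)) pos)) (sym (+-suc (2 * k) (rank u))))))))

  slot-at : ∀ p (s : Special (layout ⟨$⟩ʳ p)) → toℕ p ≡ slot s
  slot-at p s = trans (sym (position-at p)) (position-special s)

  filler-slot-at : ∀ p → Filler (layout ⟨$⟩ʳ p) → toℕ p ≡ filler-slot (layout ⟨$⟩ʳ p)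
  filler-slot-at p filler = trans (sym (position-at p)) (position-filler filler)

  neighbour<top : ∀ {p i} → at p ≡ N → i ≢ p → at i < at p
  neighbour<top {p} {i} e i≢p = ≤∧≢⇒< (subst (at i ≤_) (sym e) (value≤size layout i)) (i≢p ∘ value-injective layout)

  bottom<neighbour : ∀ {p i} → at p ≡ 1 → i ≢ p → at p < at i
  bottom<neighbour {p} {i} e i≢p = ≤∧≢⇒< (subst (_≤ at i) (sym e) (s≤s z≤n)) (i≢p ∘ value-injective layout ∘ sym)

  pinnacle-values : ∀ x → IsPinnacle layout x → x ∈ q ⊎ x ≡ N
  pinnacle-values _ (p , refl , up , down) with special? (layout ⟨$⟩ʳ p)
  ... | yes (bottom e)     = ⊥-elim (<⇒≱ up (≤-trans (≤-reflexive e) (s≤s z≤n)))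
  ... | yes (top e)        = inj₂ e
  ... | yes (peak t e)     = inj₁ (subst (_∈ q) e (∈-lookup t q))
  ... | yes (valley t e)   = ⊥-elim (<-asym down (subst (_< at (next p)) e (after-valley (slot-at p (valley t e)))))
  ... | no filler          = ⊥-elim (<-asym up (before-filler filler (filler-slot-at p filler)))

  pinnacle-from : ∀ x → x ∈ q ⊎ x ≡ N → IsPinnacle layout x
  pinnacle-from x (inj₁ x∈q) =
    p , trans at-p (sym (lookup-index x∈q)) ,
    subst (at (prev p) <_) (sym at-p) (before-peak p-slot) ,
    subst₂ _<_ (sym (after-peak p-slot)) (sym at-p) (w<q t)
    where
    t = index x∈q
    u = proj₁ (peak-index t)
    e = proj₂ (peak-index t)
    p = proj₁ (occurrence u)
    at-p : at p ≡ lookup q t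
    at-p = trans (proj₁ (proj₂ (occurrence u))) (sym e)
    p-slot : toℕ p ≡ 2 * toℕ t
    p-slot = trans (proj₂ (proj₂ (occurrence u))) (position-special (peak t e))
  pinnacle-from _ (inj₂ refl) =
    let (u , e) = top-index ; (p , at-p , _) = occurrence u ; at-p′ = trans at-p e in
    p , at-p′ , neighbour<top at-p′ (prev≢ p) , neighbour<top at-p′ (next≢ p)

  vale-values : ∀ x → IsVale layout x → x ∈ w ⊎ x ≡ 1
  vale-values _ (p , refl , down , up) with special? (layout ⟨$⟩ʳ p)
  ... | yes (bottom e)     = inj₂ e
  ... | yes (top e)        = ⊥-elim (<⇒≱ up (≤-trans (value≤size layout (next p)) (≤-reflexive (sym e))))
  ... | yes (peak t e)     = ⊥-elim (<-asym up (subst (at (next p) <_) e (subst (_< lookup q t) (sym (after-peak (slot-at p (peak t e)))) (w<q t))))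
  ... | yes (valley t e)   = inj₁ (subst (_∈ w) e (∈-lookup t w))
  ... | no filler          = ⊥-elim (<-asym up (after-filler filler (filler-slot-at p filler)))

  vale-from : ∀ x → x ∈ w ⊎ x ≡ 1 → IsVale layout x
  vale-from x (inj₁ x∈w) =
    p , trans at-p (sym (lookup-index x∈w)) ,
    subst₂ _<_ (sym at-p) (sym (before-valley p-slot)) (w<q t) ,
    subst (_< at (next p)) (sym at-p) (after-valley p-slot)
    where
    t = index x∈w
    u = proj₁ (valley-index t)
    e = proj₂ (valley-index t)
    p = proj₁ (occurrence u)
    at-p : at p ≡ lookup w t
    at-p = trans (proj₁ (proj₂ (occurrence u))) (sym e)
    p-slot : toℕ p ≡ suc (2 * toℕ t)
    p-slot = trans (proj₂ (proj₂ (occurrence u))) (position-special (valley t e))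
  vale-from _ (inj₂ refl) =
    let (p , at-p , _) = occurrence zero in
    p , at-p , bottom<neighbour at-p (prev≢ p) , bottom<neighbour at-p (next≢ p)

  admissible : Admissible (_∈ q) (_∈ w)
  admissible =
    N , (λ x x∈q → subst (_< N) (sym (lookup-index x∈q)) (q<N (index x∈q))) , layout ,
    (λ x → mk⇔ (pinnacle-values x) (pinnacle-from x)) , (λ x → mk⇔ (vale-values x) (vale-from x))

proposition3p6 : (k : ℕ) (q w : Vec ℕ k) →
    (∀ i j → i <ᶠ j → lookup q i < lookup q j) →
    (∀ i j → i <ᶠ j → lookup w i < lookup w j) →
    (∀ i → 2 ≤ lookup q i) →
    (∀ i → 2 ≤ lookup w i) →
    (∀ i j → lookup q i ≢ lookup w j) →
    Admissible (_∈ q) (_∈ w) ⇔ (∀ j → lookup w j < lookup q j)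
proposition3p6 k q w q-increasing w-increasing q≥2 w≥2 q≢w =
  mk⇔ (interlacing-necessary q w q-increasing w-increasing q≥2 q≢w)
      (Construction.admissible q w q-increasing w-increasing q≥2 w≥2 q≢w)
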